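{- Let $G$ be a finite simple graph and let $(b_1,b_2,\ldots,b_k)$ be a sequence of vertices of $G$. Then: (1) there exist vertices $a_1,\ldots,a_k$ such that $(a_i\to b_i)_{i=1}^k$ is the chronological list of a successful zero forcing game with CCR-$Z$ if and only if $(b_k,b_{k-1},\ldots,b_1)$ is a $Z$-sequence; (2) there exist vertices $a_1,\ldots,a_k$ such that $(a_i\to b_i)_{i=1}^k$ is the chronological list of a successful zero forcing game with CCR-$Z_{\dot\ell}$ if and only if $(b_k,\ldots,b_1)$ is a dominating sequence; (3) there exist vertices $a_1,\ldots,a_k$ such that $(a_i\to b_i)_{i=1}^k$ is the chronological list of a successful zero forcing game with CCR-$Z_-$ if and only if $(b_k,\ldots,b_1)$ is a total dominating sequence; (4) there exist vertices $a_1,\ldots,a_k$ such that $(a_i\to b_i)_{i=1}^k$ is the chronological list of a successful zero forcing game with CCR-$Z_L$ if and only if $(b_k,\ldots,b_1)$ is an $L$-sequence.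
   Context: For a vertex $x$, $N(x)$ is its open neighborhood and $N[x]=N(x)\cup\{x\}$ its closed neighborhood. Vertices are colored blue or white. Color change rules: (CCR-$Z$) if $y\in N(x)$ and all of $N[x]$ is blue except $y$, then $x$ forces $y$ blue; (CCR-$Z_{\dot\ell}$) if $y\in N[x]$ and all of $N[x]$ is blue except $y$, then $x$ forces $y$ blue (here $y=x$ is allowed); (CCR-$Z_-$) if $y\in N(x)$ and all of $N(x)$ is blue except $y$, then $x$ forces $y$ blue; (CCR-$Z_L$) $x$ forces $y$ if either $x\neq y$ and the CCR-$Z_-$ force $x\to y$ applies, or $x=y$ and the CCR-$Z_{\dot\ell}$ force $x\to x$ applies. A zero forcing game starts with some vertices blue and applies forces one at a time; the chronological list records the performed forces $a_i\to b_i$ in order (each force turns a white vertex $b_i$ blue). The game is successful if all vertices are blue at the end; in that case the initial blue set is $V(G)\setminus\{b_1,\ldots,b_k\}$. A sequence $(v_1,\ldots,v_k)$ of distinct vertices is: a $Z$-sequence if $N(v_i)\setminus\bigcup_{j<i}N[v_j]\neq\emptyset$ for all $i$; a dominating sequence if $N[v_i]\setminus\bigcup_{j<i}N[v_j]\neq\emptyset$ for all $i$; a total dominating sequence if $N(v_i)\setminus\bigcup_{j<i}N(v_j)\neq\emptyset$ for all $i$; an $L$-sequence if $N[v_i]\setminus\bigcup_{j<i}N(v_j)\neq\emptyset$ for all $i$. -}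

module Defs where

open import Data.Nat using (ℕ)
open import Data.Fin using (Fin; _<_)
open import Data.Fin.Subset using (Subset; _∈_; _∉_; _∪_; ⁅_⁆; ⊤)
open import Data.List using (List; []; _∷_; map; length; lookup; reverse)
open import Data.List.Relation.Unary.Unique.Propositional using (Unique)
open import Data.Product using (Σ; ∃; _×_; proj₂)
open import Data.Sum using (_⊎_)
open import Relation.Nullary using (¬_; Dec)
open import Relation.Binary.PropositionalEquality using (_≡_; _≢_)

record Graph : Set₁ where
  field
    n      : ℕ
    Adj    : Fin n → Fin n → Set
    sym    : ∀ {x y} → Adj x y → Adj y x
    irrefl : ∀ {x} → ¬ Adj x x
    dec    : ∀ x y → Dec (Adj x y)

module _ (G : Graph) where
  open Graph G

  InOpen : Fin n → Fin n → Set
  InOpen x w = Adj x w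

  InClosed : Fin n → Fin n → Set
  InClosed x w = w ≡ x ⊎ Adj x w

  -- A color change rule: given the current blue set S, does x force y?
  Rule : Set₁
  Rule = Subset n → Fin n → Fin n → Set

  ccrZ : Rule
  ccrZ S x y = InOpen x y × (∀ w → InClosed x w → w ≢ y → w ∈ S)

  ccrZdot : Rule
  ccrZdot S x y = InClosed x y × (∀ w → InClosed x w → w ≢ y → w ∈ S)

  ccrZminus : Rule
  ccrZminus S x y = InOpen x y × (∀ w → InOpen x w → w ≢ y → w ∈ S)

  ccrZL : Rule
  ccrZL S x y = (x ≢ y × ccrZminus S x y) ⊎ (x ≡ y × ccrZdot S x x)

  data Game (R : Rule) : Subset n → List (Fin n × Fin n) → Subset n → Set where
    done  : ∀ {S} → Game R S [] S
    force : ∀ {S a b fs T} → b ∉ S → R S a b →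
            Game R (S ∪ ⁅ b ⁆) fs T → Game R S ((a Data.Product., b) ∷ fs) T

  SuccessfulList : Rule → List (Fin n × Fin n) → Set
  SuccessfulList R fs = ∃ λ S → Game R S fs ⊤

  HasChronologicalList : Rule → List (Fin n) → Set
  HasChronologicalList R bs =
    ∃ λ (fs : List (Fin n × Fin n)) → map proj₂ fs ≡ bs × SuccessfulList R fs

  GenSeq : (Fin n → Fin n → Set) → (Fin n → Fin n → Set) → List (Fin n) → Set
  GenSeq P Q vs =
    Unique vs ×
    (∀ (i : Fin (length vs)) →
       ∃ λ w → P (lookup vs i) w × (∀ (j : Fin (length vs)) → j < i → ¬ Q (lookup vs j) w))

  IsZSequence IsDominatingSequence IsTotalDominatingSequence IsLSequence : List (Fin n) → Set
  IsZSequence               = GenSeq InOpen   InClosed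
  IsDominatingSequence      = GenSeq InClosed InClosed
  IsTotalDominatingSequence = GenSeq InOpen   InOpen
  IsLSequence               = GenSeq InClosed InOpen

module Submission where

-- All four statements are instances of one argument, parametrised by a pair of
-- relations P, Q (open/closed neighbourhoods).  Both sides are shown equivalent
-- to a common middle condition on the chronological list bs:
--   bs has no repetitions, and every b in bs has a "private witness" w with
--   P b w such that no vertex forced after b is Q-related to w.
-- (1) Sequences: the indexed condition of GenSeq is first recast as a left-to-right
--     scan with an accumulator of earlier vertices, and scanning reverse bs is the
--     middle condition on bs (a scan splits along _++_).
-- (2) Games: call b "exposed" in blue set S if b has a witness w with P b w that
--     no other white vertex Q-sees.  For a rule under which b is forcible exactly
--     when it is exposed, a game's forced list satisfies the middle condition,
--     and conversely the middle condition lets us play the game from the blue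
--     set ∁ bs.  Finally each of the four rules is shown to have this property
--     (for CCR-Z, Z_ℓ̇, Z_- the forcer itself is the witness).

open import Defs
open import Data.Empty using (⊥-elim)
open import Data.Fin using (Fin; zero; suc; _<_)
open import Data.Fin.Subset using (Subset; _∈_; _∉_; _∪_; ⁅_⁆; ⊤; ∁; ⋃)
open import Data.Fin.Subset.Properties
  using (_∈?_; x∈p∪q⁺; x∈p∪q⁻; x∈⁅x⁆; x∈⁅y⁆⇒x≡y; x∈p⇒x∉∁p; x∉∁p⇒x∈p; ∉⊥; ⊆⊤; ⊆-antisym)
open import Data.List using (List; []; _∷_; _++_; [_]; map; lookup; reverse; reverseAcc)
open import Data.List.Properties using (unfold-reverse; reverse-involutive)
open import Data.List.Membership.Propositional using () renaming (_∈_ to _∈ₗ_)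
open import Data.List.Relation.Unary.All as All using (All; []; _∷_)
open import Data.List.Relation.Unary.AllPairs using ([]; _∷_)
open import Data.List.Relation.Unary.Any using (here; there)
open import Data.List.Relation.Unary.Any.Properties using (¬Any[])
open import Data.List.Relation.Unary.Unique.Propositional using (Unique)
open import Data.List.Relation.Binary.Permutation.Propositional using (↭-sym; ↭⇒↭ₛ)
open import Data.List.Relation.Binary.Permutation.Propositional.Properties using (↭-reverse)
open import Data.List.Relation.Binary.Permutation.Setoid.Properties using (Unique-resp-↭)
open import Data.Nat using (z≤n; s≤s)
open import Data.Product using (_×_; _,_; ∃; proj₁; proj₂)
open import Data.Sum using (inj₁; inj₂)
open import Data.Unit using (tt) renaming (⊤ to Unit)
open import Function.Bundles using (_⇔_; mk⇔; Equivalence)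
import Function.Properties.Equivalence as ⇔
open import Relation.Binary.Definitions using (Symmetric)
open import Relation.Binary.PropositionalEquality
  using (_≡_; _≢_; refl; sym; cong; subst; setoid)
open import Relation.Nullary using (¬_)
open import Relation.Nullary.Decidable using (decidable-stable)

open Equivalence using (to; from)

module _ {A : Set} where
  unique-reverse : (xs : List A) → Unique (reverse xs) ⇔ Unique xs
  unique-reverse xs = mk⇔ (Unique-resp-↭ (setoid A) (↭⇒↭ₛ (↭-reverse xs)))
                          (Unique-resp-↭ (setoid A) (↭⇒↭ₛ (↭-sym (↭-reverse xs))))

module Witnesses {A B : Set} (P Q : A → B → Set) where

  PrivateWitness : List A → A → Set
  PrivateWitness others v = ∃ λ w → P v w × All (λ u → ¬ Q u w) others

  WitnessedBackward : List A → Set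
  WitnessedBackward []       = Unit
  WitnessedBackward (v ∷ vs) = PrivateWitness vs v × WitnessedBackward vs

  WitnessedForward : List A → List A → Set
  WitnessedForward acc []       = Unit
  WitnessedForward acc (v ∷ vs) = PrivateWitness acc v × WitnessedForward (v ∷ acc) vs

  WitnessedByIndex : List A → List A → Set
  WitnessedByIndex acc vs = ∀ i → ∃ λ w → P (lookup vs i) w ×
    All (λ u → ¬ Q u w) acc × (∀ j → j < i → ¬ Q (lookup vs j) w)

  -- Positional and scan forms agree: peel off the first position, moving it into
  -- the accumulator.
  byIndex⇒forward : ∀ {acc} vs → WitnessedByIndex acc vs → WitnessedForward acc vs
  byIndex⇒forward []       _  = tt
  byIndex⇒forward {acc} (v ∷ vs) ix = first , byIndex⇒forward vs rest
    where
    first : PrivateWitness acc v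
    first = let (w , p , unseen , _) = ix zero in w , p , unseen
    rest : WitnessedByIndex (v ∷ acc) vs
    rest i = let (w , p , unseen , earlier) = ix (suc i) in
      w , p , earlier zero (s≤s z≤n) ∷ unseen , λ j j<i → earlier (suc j) (s≤s j<i)

  -- Conversely, position suc i of v ∷ vs is position i of vs, with v in the accumulator.
  forward⇒byIndex : ∀ {acc} vs → WitnessedForward acc vs → WitnessedByIndex acc vs
  forward⇒byIndex (v ∷ vs) ((w , p , unseen) , _) zero = w , p , unseen , λ _ ()
  forward⇒byIndex (v ∷ vs) (_ , ws) (suc i) with forward⇒byIndex vs ws i
  ... | w , p , v-unseen ∷ unseen , earlier = w , p , unseen , earlier′
    where
    earlier′ : ∀ j → j < suc i → ¬ Q (lookup (v ∷ vs) j) w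
    earlier′ zero    _         = v-unseen
    earlier′ (suc j) (s≤s j<i) = earlier j j<i

  forward-++ : ∀ acc xs ys → WitnessedForward acc (xs ++ ys) ⇔
    (WitnessedForward acc xs × WitnessedForward (reverseAcc acc xs) ys)
  forward-++ acc xs ys = mk⇔ (split acc xs) (join acc xs)
    where
    split : ∀ acc xs → WitnessedForward acc (xs ++ ys) →
      WitnessedForward acc xs × WitnessedForward (reverseAcc acc xs) ys
    split acc []       ws        = tt , ws
    split acc (x ∷ xs) (wx , ws) = let (ws₁ , ws₂) = split (x ∷ acc) xs ws in (wx , ws₁) , ws₂
    join : ∀ acc xs → WitnessedForward acc xs × WitnessedForward (reverseAcc acc xs) ys →
      WitnessedForward acc (xs ++ ys)
    join acc []       (_ , ws₂)         = ws₂
    join acc (x ∷ xs) ((wx , ws₁) , ws₂) = wx , join (x ∷ acc) xs (ws₁ , ws₂)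

  forward-reverse : ∀ bs → WitnessedForward [] (reverse bs) ⇔ WitnessedBackward bs
  forward-reverse []       = ⇔.refl
  forward-reverse (b ∷ bs) = mk⇔
    (λ ws → let (ws₁ , (wb , _)) = to split ws in
              subst (λ l → PrivateWitness l b) (reverse-involutive bs) wb , to (forward-reverse bs) ws₁)
    (λ (wb , ws) → from split
      (from (forward-reverse bs) ws , subst (λ l → PrivateWitness l b) (sym (reverse-involutive bs)) wb , tt))
    where
    split : WitnessedForward [] (reverse (b ∷ bs)) ⇔
      (WitnessedForward [] (reverse bs) × WitnessedForward (reverse (reverse bs)) [ b ])
    split = subst (λ l → WitnessedForward [] l ⇔
                    (WitnessedForward [] (reverse bs) × WitnessedForward (reverse (reverse bs)) [ b ]))
                  (sym (unfold-reverse b bs))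
                  (forward-++ [] (reverse bs) [ b ])

module _ (G : Graph) where
  open Graph G renaming (sym to adj-sym)
  open Witnesses

  genSeq-reverse : ∀ P Q bs → GenSeq G P Q (reverse bs) ⇔ (Unique bs × WitnessedBackward P Q bs)
  genSeq-reverse P Q bs = mk⇔
    (λ (u , ix) → to (unique-reverse bs) u ,
       to (forward-reverse P Q bs) (byIndex⇒forward P Q _ (λ i → let (w , p , e) = ix i in w , p , [] , e)))
    (λ (u , wb) → from (unique-reverse bs) u ,
       λ i → let (w , p , _ , e) = forward⇒byIndex P Q _ (from (forward-reverse P Q bs) wb) i in w , p , e)

  Exposed : (P Q : Fin n → Fin n → Set) → Subset n → Fin n → Set
  Exposed P Q S b = ∃ λ w → P b w × (∀ v → v ∉ S → v ≢ b → ¬ Q v w)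

  white-∪⁅⁆⁻ : ∀ {S : Subset n} {b v : Fin n} → v ∉ S ∪ ⁅ b ⁆ → v ∉ S × v ≢ b
  white-∪⁅⁆⁻ {b = b} v∉ = (λ v∈S → v∉ (x∈p∪q⁺ (inj₁ v∈S))) ,
                          (λ { refl → v∉ (x∈p∪q⁺ (inj₂ (x∈⁅x⁆ b))) })

  white-∪⁅⁆⁺ : ∀ {S : Subset n} {b v : Fin n} → v ∉ S → v ≢ b → v ∉ S ∪ ⁅ b ⁆
  white-∪⁅⁆⁺ {S} {b} v∉S v≢b v∈ with x∈p∪q⁻ S ⁅ b ⁆ v∈
  ... | inj₁ v∈S = v∉S v∈S
  ... | inj₂ v∈b = v≢b (x∈⁅y⁆⇒x≡y b v∈b)

  WhiteExactly : Subset n → List (Fin n) → Set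
  WhiteExactly S bs = ∀ v → v ∉ S ⇔ v ∈ₗ bs

  white-force : ∀ {S b bs} → WhiteExactly S (b ∷ bs) → All (b ≢_) bs → WhiteExactly (S ∪ ⁅ b ⁆) bs
  white-force {S} {b} {bs} white b∉bs v = mk⇔ later (λ v∈bs → white-∪⁅⁆⁺ (from (white v) (there v∈bs)) (b≢ v∈bs))
    where
    later : v ∉ S ∪ ⁅ b ⁆ → v ∈ₗ bs
    later v∉ = let (v∉S , v≢b) = white-∪⁅⁆⁻ v∉ in not-head v≢b (to (white v) v∉S)
      where
      not-head : v ≢ b → v ∈ₗ b ∷ bs → v ∈ₗ bs
      not-head v≢b (here v≡b)   = ⊥-elim (v≢b v≡b)
      not-head _   (there v∈bs) = v∈bs
    b≢ : v ∈ₗ bs → v ≢ b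
    b≢ v∈bs v≡b = All.lookup b∉bs v∈bs (sym v≡b)

  white-none : ∀ {S} → WhiteExactly S [] → S ≡ ⊤
  white-none {S} white = ⊆-antisym ⊆⊤ (λ {v} _ → decidable-stable (v ∈? S) (λ v∉S → ¬Any[] (to (white v) v∉S)))

  ∈⋃⁅⁆⁺ : ∀ {v : Fin n} bs → v ∈ₗ bs → v ∈ ⋃ (map ⁅_⁆ bs)
  ∈⋃⁅⁆⁺ (b ∷ bs) (here refl)  = x∈p∪q⁺ (inj₁ (x∈⁅x⁆ b))
  ∈⋃⁅⁆⁺ (b ∷ bs) (there v∈bs) = x∈p∪q⁺ (inj₂ (∈⋃⁅⁆⁺ bs v∈bs))

  ∈⋃⁅⁆⁻ : ∀ {v : Fin n} bs → v ∈ ⋃ (map ⁅_⁆ bs) → v ∈ₗ bs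
  ∈⋃⁅⁆⁻ []       v∈ = ⊥-elim (∉⊥ v∈)
  ∈⋃⁅⁆⁻ (b ∷ bs) v∈ with x∈p∪q⁻ ⁅ b ⁆ (⋃ (map ⁅_⁆ bs)) v∈
  ... | inj₁ v∈b  = here (x∈⁅y⁆⇒x≡y b v∈b)
  ... | inj₂ v∈bs = there (∈⋃⁅⁆⁻ bs v∈bs)

  white-complement : ∀ (bs : List (Fin n)) → WhiteExactly (∁ (⋃ (map ⁅_⁆ bs))) bs
  white-complement bs v = mk⇔ (λ v∉ → ∈⋃⁅⁆⁻ bs (x∉∁p⇒x∈p v∉)) (λ v∈ → x∈p⇒x∉∁p (∈⋃⁅⁆⁺ bs v∈))

  module Games (P Q : Fin n → Fin n → Set) (R : Rule G)
    (exposure : ∀ {S b} → (∃ λ a → R S a b) ⇔ Exposed P Q S b) where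

    forced-white : ∀ {S fs T} → Game G R S fs T → All (_∉ S) (map proj₂ fs)
    forced-white done              = []
    forced-white (force b∉S _ game) = b∉S ∷ All.map (λ v∉ → proj₁ (white-∪⁅⁆⁻ v∉)) (forced-white game)

    -- Soundness: the forced list is repetition-free and chronologically witnessed,
    -- the forcing vertex's witness being unseen by the later (still white) vertices.
    game-sound : ∀ {S fs T} → Game G R S fs T →
      Unique (map proj₂ fs) × WitnessedBackward P Q (map proj₂ fs)
    game-sound done = [] , tt
    game-sound (force {a = a} b∉S r game) with forced-white game | game-sound game | to exposure (a , r)
    ... | later-white | u , ws | w , p , unseen =
      All.map (λ v∉ b≡v → proj₂ (white-∪⁅⁆⁻ v∉) (sym b≡v)) later-white ∷ u ,
      (w , p , All.map (λ {v} v∉ → let (v∉S , v≢b) = white-∪⁅⁆⁻ v∉ in unseen v v∉S v≢b) later-white) , ws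

    game-complete : ∀ {S} bs → WhiteExactly S bs → Unique bs → WitnessedBackward P Q bs →
      ∃ λ fs → map proj₂ fs ≡ bs × Game G R S fs ⊤
    game-complete {S} [] white _ _ = [] , refl , subst (Game G R S []) (white-none white) done
    game-complete {S} (b ∷ bs) white (b∉bs ∷ u) ((w , p , unseen) , ws) =
      let (a , r)         = from exposure (w , p , exposed)
          (fs , eq , game) = game-complete bs (white-force white b∉bs) u ws
      in (a , b) ∷ fs , cong (b ∷_) eq , force (from (white b) (here refl)) r game
      where
      exposed : ∀ v → v ∉ S → v ≢ b → ¬ Q v w
      exposed v v∉S v≢b with to (white v) v∉S
      ... | here v≡b   = ⊥-elim (v≢b v≡b)
      ... | there v∈bs = All.lookup unseen v∈bs

    game⇔ : ∀ bs → HasChronologicalList G R bs ⇔ (Unique bs × WitnessedBackward P Q bs)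
    game⇔ bs = mk⇔
      (λ (fs , eq , _ , game) → subst (λ l → Unique l × WitnessedBackward P Q l) eq (game-sound game))
      (λ (u , ws) → let (fs , eq , game) = game-complete bs (white-complement bs) u ws
                    in fs , eq , _ , game)

    characterisation : ∀ bs → HasChronologicalList G R bs ⇔ GenSeq G P Q (reverse bs)
    characterisation bs = ⇔.trans (game⇔ bs) (⇔.sym (genSeq-reverse P Q bs))

  open-sym : Symmetric (InOpen G)
  open-sym = adj-sym

  closed-sym : Symmetric (InClosed G)
  closed-sym (inj₁ eq)  = inj₁ (sym eq)
  closed-sym (inj₂ adj) = inj₂ (adj-sym adj)

  -- A "threshold" rule: a forces b if P a b and all other Q-neighbours of a are blue
  -- (CCR-Z, Z_ℓ̇ and Z_- are of this form).  For symmetric P, Q the forcer is the witness.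
  threshold-exposure : ∀ {P Q : Fin n → Fin n → Set} → Symmetric P → Symmetric Q → ∀ {S b} →
    (∃ λ a → P a b × (∀ w → Q a w → w ≢ b → w ∈ S)) ⇔ Exposed P Q S b
  threshold-exposure P-sym Q-sym {S} = mk⇔
    (λ (a , p , blue) → a , P-sym p , λ v v∉S v≢b q → v∉S (blue v (Q-sym q) v≢b))
    (λ (w , p , unseen) → w , P-sym p ,
       λ u q u≢b → decidable-stable (u ∈? S) (λ u∉S → unseen u u∉S u≢b (Q-sym q)))

  -- CCR-Z_L combines an open-neighbourhood force (witness a neighbour) with a
  -- self-force (witness b itself).
  ZL-exposure : ∀ {S b} → (∃ λ a → ccrZL G S a b) ⇔ Exposed (InClosed G) (InOpen G) S b
  ZL-exposure {S} {b} = mk⇔ exposed forcer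
    where
    open-exposure : (∃ λ a → ccrZminus G S a b) ⇔ Exposed (InOpen G) (InOpen G) S b
    open-exposure = threshold-exposure {InOpen G} {InOpen G} open-sym open-sym {S} {b}

    exposed : (∃ λ a → ccrZL G S a b) → Exposed (InClosed G) (InOpen G) S b
    exposed (a , inj₁ (_ , r)) = let (w , adj , unseen) = to open-exposure (a , r) in w , inj₂ adj , unseen
    exposed (_ , inj₂ (refl , _ , blue)) = b , inj₁ refl , λ v v∉S v≢b adj → v∉S (blue v (inj₂ (adj-sym adj)) v≢b)

    forcer : Exposed (InClosed G) (InOpen G) S b → ∃ λ a → ccrZL G S a b
    forcer (w , inj₂ adj , unseen) = let (a , r) = from open-exposure (w , adj , unseen) in
      a , inj₁ ((λ { refl → irrefl (proj₁ r) }) , r)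
    forcer (_ , inj₁ refl , unseen) = b , inj₂ (refl , inj₁ refl , blue)
      where
      blue : ∀ u → InClosed G b u → u ≢ b → u ∈ S
      blue u (inj₁ u≡b) u≢b = ⊥-elim (u≢b u≡b)
      blue u (inj₂ adj) u≢b = decidable-stable (u ∈? S) (λ u∉S → unseen u u∉S u≢b (adj-sym adj))

lemma2p1 : (G : Graph) → (bs : List (Fin (Graph.n G))) →
    (HasChronologicalList G (ccrZ G) bs ⇔ IsZSequence G (reverse bs)) ×
    (HasChronologicalList G (ccrZdot G) bs ⇔ IsDominatingSequence G (reverse bs)) ×
    (HasChronologicalList G (ccrZminus G) bs ⇔ IsTotalDominatingSequence G (reverse bs)) ×
    (HasChronologicalList G (ccrZL G) bs ⇔ IsLSequence G (reverse bs))
lemma2p1 G bs =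
  Games.characterisation G (InOpen G)   (InClosed G) (ccrZ G)      (threshold-exposure G (open-sym G) (closed-sym G)) bs ,
  Games.characterisation G (InClosed G) (InClosed G) (ccrZdot G)   (threshold-exposure G (closed-sym G) (closed-sym G)) bs ,
  Games.characterisation G (InOpen G)   (InOpen G)   (ccrZminus G) (threshold-exposure G (open-sym G) (open-sym G)) bs ,
  Games.characterisation G (InClosed G) (InOpen G)   (ccrZL G)     (ZL-exposure G) bs
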